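{- Let $n\ge 9$. For each integer $a$ with $2\le a\le \lfloor (n-1)/3\rfloor$ and $n-a\equiv 1\pmod 2$, the partition $\left(\tfrac12(n-a-1),\ a+1,\ 3,\ 1\times \tfrac12(n-a-7)\right)$ of $n$ corresponds to the eigenvalue $\binom{a}{2}-1$ of $\mathrm{Cay}(S_n,T_n)$.
   Context: $\mathrm{Cay}(S_n,T_n)$ is the Cayley graph on the symmetric group $S_n$ generated by the set $T_n$ of all transpositions ($f\sim g$ iff $fg^{ -1}\in T_n$). For a partition $\lambda=(\lambda_1,\dots,\lambda_k)$ of $n$ (parts listed in the order written), put $\rho_\lambda=\sum_{i=1}^k \lambda_i(\lambda_i-2i+1)/2$; the eigenvalues of $\mathrm{Cay}(S_n,T_n)$ are exactly the numbers $\rho_\lambda$ as $\lambda$ ranges over partitions of $n$, and $\lambda$ is said to correspond to the eigenvalue $\rho_\lambda$. The notation $(\mu_1\times t_1,\dots,\mu_r\times t_r)$ denotes the sequence in which $\mu_i$ is repeated $t_i$ times; an entry $\mu$ without "$\times t$" is a single part, and $\mu\times 0$ contributes no parts. -}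

module Defs where

open import Data.Nat as ℕ using (ℕ; zero; suc)
open import Data.Integer as ℤ using (ℤ; +_)
open import Data.Integer.DivMod using (_/ℕ_)
open import Data.List using (List; []; _∷_)

rhoTerm : ℕ → ℕ → ℤ
rhoTerm i l = ((+ l) ℤ.* ((+ l) ℤ.- (+ (2 ℕ.* i)) ℤ.+ (+ 1))) /ℕ 2

rhoFrom : ℕ → List ℕ → ℤ
rhoFrom i [] = + 0
rhoFrom i (l ∷ ls) = rhoTerm i l ℤ.+ rhoFrom (suc i) ls

-- ρ_λ = Σ_{i=1}^k λ_i (λ_i - 2i + 1)/2, parts taken in the order listed
rho : List ℕ → ℤ
rho = rhoFrom 1

{-# OPTIONS --safe #-}
-- Write n − a = 2m + 1; then 3a < n and n ≥ 9 force m ≥ 3, and the partition is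
-- (m, a + 1, 3, 1 × (m − 3)).  A part l in position i + 1 contributes C(l,2) − l·i
-- to ρ, so the parts contribute C(m,2), C(a,2) − 1 and −3, while the ones in
-- positions 4, …, m telescope to C(3,2) − C(m,2).  Everything but C(a,2) − 1 cancels.
module Submission where

open import Defs
open import Data.Nat using (ℕ; _≤_; _∸_; _+_; _/_; _%_)
open import Data.Nat.Combinatorics using (_C_)
open import Data.Integer as ℤ using (ℤ; +_)
open import Data.List using (List; []; _∷_; replicate)
open import Data.Nat.ListAction using (sum)
open import Data.Product using (_×_; _,_)
open import Relation.Binary.PropositionalEquality using (_≡_)

open import Data.Nat as ℕ using (zero; suc; _*_; _<_; s≤s; z<s; NonZero)
open import Data.Nat.Combinatorics using (nC1≡n; nCk+nC[k+1]≡[n+1]C[k+1])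
open import Data.Integer.DivMod using (_/ℕ_)
import Data.Integer.Tactic.RingSolver as ℤSolver
import Data.Integer.Properties as ℤ
import Data.Nat.Tactic.RingSolver as ℕSolver
import Data.Nat.Properties as ℕ
open import Data.Nat.DivMod using (m*n%n≡0; m*n/n≡m; m/n*n≤m; m≡m%n+[m/n]*n)
open import Relation.Binary.PropositionalEquality
  using (refl; sym; trans; cong; cong₂; subst; module ≡-Reasoning)

[i*2]/ℕ2≡i : ∀ i → (i ℤ.* + 2) /ℕ 2 ≡ i
[i*2]/ℕ2≡i (+ zero)  = refl
[i*2]/ℕ2≡i (+ suc m) = cong +_ (m*n/n≡m (suc m) 2)
-- On a negative dividend _/ℕ_ branches on whether the remainder vanishes.
[i*2]/ℕ2≡i ℤ.-[1+ m ] with suc (suc (m * 2)) ℕ.% 2 | m*n%n≡0 (suc m) 2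
... | .0 | refl = cong (λ t → ℤ.- (+ t)) (m*n/n≡m (suc m) 2)

l[l-2i+1]≡z*2⇒rhoTerm≡z : ∀ i l z →
  + l ℤ.* (+ l ℤ.- + 2 ℤ.* + i ℤ.+ + 1) ≡ z ℤ.* + 2 → rhoTerm i l ≡ z
l[l-2i+1]≡z*2⇒rhoTerm≡z i l z eq rewrite ℤ.pos-* 2 i | eq = [i*2]/ℕ2≡i z

[1+n]C2≡n+nC2 : ∀ n → suc n C 2 ≡ n + n C 2
[1+n]C2≡n+nC2 n = trans (sym (nCk+nC[k+1]≡[n+1]C[k+1] n 1)) (cong (_+ n C 2) (nC1≡n n))

nC2*2≡n[n-1] : ∀ n → + (n C 2) ℤ.* + 2 ≡ + n ℤ.* (+ n ℤ.- + 1)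
nC2*2≡n[n-1] zero    = refl
nC2*2≡n[n-1] (suc n) = begin
  + (suc n C 2) ℤ.* + 2                  ≡⟨ cong (λ c → + c ℤ.* + 2) ([1+n]C2≡n+nC2 n) ⟩
  + (n + n C 2) ℤ.* + 2                  ≡⟨ cong (ℤ._* + 2) (ℤ.pos-+ n (n C 2)) ⟩
  (+ n ℤ.+ + (n C 2)) ℤ.* + 2            ≡⟨ ℤ.*-distribʳ-+ (+ 2) (+ n) (+ (n C 2)) ⟩
  + n ℤ.* + 2 ℤ.+ + (n C 2) ℤ.* + 2      ≡⟨ cong (λ t → + n ℤ.* + 2 ℤ.+ t) (nC2*2≡n[n-1] n) ⟩
  + n ℤ.* + 2 ℤ.+ + n ℤ.* (+ n ℤ.- + 1)  ≡⟨ pascal (+ n) ⟩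
  + suc n ℤ.* (+ suc n ℤ.- + 1)          ∎
  where
  open ≡-Reasoning
  pascal : ∀ x → x ℤ.* + 2 ℤ.+ x ℤ.* (x ℤ.- + 1) ≡ (+ 1 ℤ.+ x) ℤ.* ((+ 1 ℤ.+ x) ℤ.- + 1)
  pascal = ℤSolver.solve-∀

rhoTerm-suc : ∀ i l → rhoTerm (suc i) l ≡ + (l C 2) ℤ.- + l ℤ.* + i
rhoTerm-suc i l = l[l-2i+1]≡z*2⇒rhoTerm≡z (suc i) l _ (begin
  + l ℤ.* (+ l ℤ.- + 2 ℤ.* + suc i ℤ.+ + 1)
    ≡⟨ expand (+ l) (+ i) ⟩
  + l ℤ.* (+ l ℤ.- + 1) ℤ.- + l ℤ.* + i ℤ.* + 2
    ≡⟨ cong (λ t → t ℤ.- + l ℤ.* + i ℤ.* + 2) (nC2*2≡n[n-1] l) ⟨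
  + (l C 2) ℤ.* + 2 ℤ.- + l ℤ.* + i ℤ.* + 2
    ≡⟨ factor (+ (l C 2)) (+ l ℤ.* + i) ⟩
  (+ (l C 2) ℤ.- + l ℤ.* + i) ℤ.* + 2 ∎)
  where
  open ≡-Reasoning
  expand : ∀ x y →
    x ℤ.* (x ℤ.- + 2 ℤ.* (+ 1 ℤ.+ y) ℤ.+ + 1) ≡ x ℤ.* (x ℤ.- + 1) ℤ.- x ℤ.* y ℤ.* + 2
  expand = ℤSolver.solve-∀
  factor : ∀ x y → x ℤ.* + 2 ℤ.- y ℤ.* + 2 ≡ (x ℤ.- y) ℤ.* + 2
  factor = ℤSolver.solve-∀

rhoFrom-ones : ∀ i k → rhoFrom (suc i) (replicate k 1) ≡ + (i C 2) ℤ.- + ((i + k) C 2)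
rhoFrom-ones i zero    rewrite ℕ.+-identityʳ i = sym (ℤ.+-inverseʳ (+ (i C 2)))
rhoFrom-ones i (suc k) = begin
  rhoTerm (suc i) 1 ℤ.+ rhoFrom (suc (suc i)) (replicate k 1)
    ≡⟨ cong₂ ℤ._+_ (rhoTerm-suc i 1) (rhoFrom-ones (suc i) k) ⟩
  + (1 C 2) ℤ.- + 1 ℤ.* + i ℤ.+ (+ (suc i C 2) ℤ.- + (suc (i + k) C 2))
    ≡⟨ cong (λ c → + (1 C 2) ℤ.- + 1 ℤ.* + i ℤ.+ (c ℤ.- + (suc (i + k) C 2))) suc-i-C2 ⟩
  + (1 C 2) ℤ.- + 1 ℤ.* + i ℤ.+ (+ i ℤ.+ + (i C 2) ℤ.- + (suc (i + k) C 2))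
    ≡⟨ telescope (+ i) (+ (i C 2)) (+ (suc (i + k) C 2)) ⟩
  + (i C 2) ℤ.- + (suc (i + k) C 2)
    ≡⟨ cong (λ j → + (i C 2) ℤ.- + (j C 2)) (ℕ.+-suc i k) ⟨
  + (i C 2) ℤ.- + ((i + suc k) C 2) ∎
  where
  open ≡-Reasoning
  suc-i-C2 : + (suc i C 2) ≡ + i ℤ.+ + (i C 2)
  suc-i-C2 = trans (cong +_ ([1+n]C2≡n+nC2 i)) (ℤ.pos-+ i (i C 2))
  telescope : ∀ x y z → + 0 ℤ.- + 1 ℤ.* x ℤ.+ (x ℤ.+ y ℤ.- z) ≡ y ℤ.- z
  telescope = ℤSolver.solve-∀

sum-replicate : ∀ k x → sum (replicate k x) ≡ k * x
sum-replicate zero    x = refl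
sum-replicate (suc k) x = cong (ℕ._+_ x) (sum-replicate k x)

hook : ℕ → ℕ → List ℕ
hook a m = m ∷ suc a ∷ 3 ∷ replicate (m ∸ 3) 1

sum-hook : ∀ a m → 3 ≤ m → sum (hook a m) ≡ a + suc (m * 2)
sum-hook a (suc (suc (suc k))) (s≤s (s≤s (s≤s _))) rewrite sum-replicate k 1 = regroup a k
  where
  regroup : ∀ a k → 3 + k + (suc a + (3 + k * 1)) ≡ a + suc ((3 + k) * 2)
  regroup = ℕSolver.solve-∀

rho-hook : ∀ a m → 3 ≤ m → rho (hook a m) ≡ + (a C 2) ℤ.- + 1
rho-hook a (suc (suc (suc k))) (s≤s (s≤s (s≤s _)))
  rewrite rhoTerm-suc 0 (3 + k) | rhoTerm-suc 1 (suc a) | rhoFrom-ones 3 k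
        | [1+n]C2≡n+nC2 a | ℤ.pos-+ a (a C 2)
  = cancel (+ ((3 + k) C 2)) (+ (3 + k)) (+ a) (+ (a C 2))
  where
  cancel : ∀ c m x y →
    c ℤ.- m ℤ.* + 0 ℤ.+ (x ℤ.+ y ℤ.- (+ 1 ℤ.+ x) ℤ.* + 1 ℤ.+ (ℤ.- + 3 ℤ.+ (+ 3 ℤ.- c)))
      ≡ y ℤ.- + 1
  cancel = ℤSolver.solve-∀

odd⇒≡1+half*2 : ∀ d → d % 2 ≡ 1 → d ≡ suc (d / 2 * 2)
odd⇒≡1+half*2 d odd = trans (m≡m%n+[m/n]*n d 2) (cong (_+ d / 2 * 2) odd)

[d∸[1+j*2]]/2≡d/2∸j : ∀ d j → d % 2 ≡ 1 → (d ∸ suc (j * 2)) / 2 ≡ d / 2 ∸ j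
[d∸[1+j*2]]/2≡d/2∸j d j odd = begin
  (d ∸ suc (j * 2)) / 2    ≡⟨ cong (λ e → (e ∸ suc (j * 2)) / 2) (odd⇒≡1+half*2 d odd) ⟩
  (d / 2 * 2 ∸ j * 2) / 2  ≡⟨ cong (_/ 2) (ℕ.*-distribʳ-∸ 2 (d / 2) j) ⟨
  (d / 2 ∸ j) * 2 / 2      ≡⟨ m*n/n≡m (d / 2 ∸ j) 2 ⟩
  d / 2 ∸ j                ∎
  where open ≡-Reasoning

odd-partition≡hook : ∀ n a → (n ∸ a) % 2 ≡ 1 →
  ((n ∸ a ∸ 1) / 2) ∷ (a + 1) ∷ 3 ∷ replicate ((n ∸ a ∸ 7) / 2) 1 ≡ hook a ((n ∸ a) / 2)
odd-partition≡hook n a odd =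
  cong₂ _∷_ (half 0) (cong₂ _∷_ (ℕ.+-comm a 1) (cong (λ k → 3 ∷ replicate k 1) (half 3)))
  where
  half : ∀ j → (n ∸ a ∸ suc (j * 2)) / 2 ≡ (n ∸ a) / 2 ∸ j
  half j = [d∸[1+j*2]]/2≡d/2∸j (n ∸ a) j odd

m≤[n∸1]/d⇒m*d<n : ∀ {m n} d .{{_ : NonZero d}} → 0 < n → m ≤ (n ∸ 1) / d → m * d < n
m≤[n∸1]/d⇒m*d<n {m} {n} d 0<n m≤ = begin-strict
  m * d            ≤⟨ ℕ.*-monoˡ-≤ d m≤ ⟩
  (n ∸ 1) / d * d  ≤⟨ m/n*n≤m (n ∸ 1) d ⟩
  n ∸ 1            <⟨ ℕ.∸-monoʳ-< z<s 0<n ⟩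
  n                ∎
  where open ℕ.≤-Reasoning

m*3<n⇒n*2<[n∸m]*3 : ∀ {m n} → m * 3 < n → n * 2 < (n ∸ m) * 3
m*3<n⇒n*2<[n∸m]*3 {m} {n} m*3<n = ℕ.+-cancelˡ-< n _ _ (begin-strict
  n + n * 2            ≡⟨ ℕSolver.solve (n ∷ []) ⟩
  n * 3                ≡⟨ cong (_* 3) (ℕ.m+[n∸m]≡n m≤n) ⟨
  (m + (n ∸ m)) * 3    ≡⟨ ℕ.*-distribʳ-+ 3 m (n ∸ m) ⟩
  m * 3 + (n ∸ m) * 3  <⟨ ℕ.+-monoˡ-< _ m*3<n ⟩
  n + (n ∸ m) * 3      ∎)
  where
  open ℕ.≤-Reasoning
  m≤n : m ≤ n
  m≤n = ℕ.≤-trans (ℕ.m≤m*n m 3) (ℕ.<⇒≤ m*3<n)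

lemma3p2 : (n a : ℕ) → 9 ≤ n → 2 ≤ a → a ≤ (n ∸ 1) / 3 → (n ∸ a) % 2 ≡ 1 →
    let lam = ((n ∸ a ∸ 1) / 2) ∷ (a + 1) ∷ 3 ∷ replicate ((n ∸ a ∸ 7) / 2) 1
    in (sum lam ≡ n) × (rho lam ≡ (+ (a C 2)) ℤ.- (+ 1))
lemma3p2 n a 9≤n _ a≤[n∸1]/3 odd =
  subst (λ lam → (sum lam ≡ n) × (rho lam ≡ + (a C 2) ℤ.- + 1))
    (sym (odd-partition≡hook n a odd))
    (trans (sum-hook a m 3≤m) a+[1+m*2]≡n , rho-hook a m 3≤m)
  where
  m : ℕ
  m = (n ∸ a) / 2
  n∸a≡1+m*2 : n ∸ a ≡ suc (m * 2)
  n∸a≡1+m*2 = odd⇒≡1+half*2 (n ∸ a) odd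
  a*3<n : a * 3 < n
  a*3<n = m≤[n∸1]/d⇒m*d<n 3 (ℕ.<-≤-trans z<s 9≤n) a≤[n∸1]/3
  a+[1+m*2]≡n : a + suc (m * 2) ≡ n
  a+[1+m*2]≡n = trans (cong (ℕ._+_ a) (sym n∸a≡1+m*2))
                      (ℕ.m+[n∸m]≡n (ℕ.≤-trans (ℕ.m≤m*n a 3) (ℕ.<⇒≤ a*3<n)))
  6<n∸a : 6 < n ∸ a
  6<n∸a = ℕ.*-cancelʳ-< 3 6 (n ∸ a)
    (ℕ.≤-<-trans (ℕ.*-monoˡ-≤ 2 9≤n) (m*3<n⇒n*2<[n∸m]*3 {a} a*3<n))
  3≤m : 3 ≤ m
  3≤m = ℕ.*-cancelʳ-≤ 3 m 2 (ℕ.≤-pred (subst (6 <_) n∸a≡1+m*2 6<n∸a))
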